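{- Let $S$ be a finite set of Boolean state variables, let $I(S)$ specify the initial states and $T(S,S')$ the transition relation of a transition system having the stuttering feature ($T(\mathbf{s},\mathbf{s})=1$ for every state $\mathbf{s}$), let $n\ge 0$, and let $H(S_{n+1})$ be a formula. If $I_0\wedge I_1\wedge T_{0,1}\wedge\dots\wedge T_{n,n+1}$ implies $H$, then $I_1\wedge T_{1,2}\wedge\dots\wedge T_{n,n+1}$ implies $H$.
   Context: $S_j$ denotes a copy of the state variables for time frame $j$; $I_0=I(S_0)$, $I_1=I(S_1)$, $T_{j,j+1}=T(S_j,S_{j+1})$. Implication is propositional entailment over all the variables involved. -}

module Defs where

open import Data.Bool using (Bool; true)
open import Data.Nat using (ℕ; suc)
open import Data.Fin using (Fin; zero; suc; inject₁; fromℕ)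
open import Relation.Binary.PropositionalEquality using (_≡_)

State : ℕ → Set
State m = Fin m → Bool

-- Formulas are represented semantically, as Boolean functions of their variables.
-- A copy S_j of the state variables for frames j = 0 .. n+1 is a trace of n+2 states.
Frames : ℕ → ℕ → Set
Frames m n = Fin (suc (suc n)) → State m

Stuttering : ∀ {m} → (State m → State m → Bool) → Set
Stuttering {m} T = ∀ (s : State m) → T s s ≡ true

Premise : ∀ {m} (n : ℕ) → (State m → Bool) → (State m → State m → Bool)
          → (State m → Bool) → Set
Premise {m} n I T H =
  ∀ (σ : Frames m n) →
    I (σ zero) ≡ true →
    I (σ (suc zero)) ≡ true →
    (∀ (j : Fin (suc n)) → T (σ (inject₁ j)) (σ (suc j)) ≡ true) →
    H (σ (fromℕ (suc n))) ≡ true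

-- I_1 ∧ T_{1,2} ∧ … ∧ T_{n,n+1} implies H(S_{n+1})
-- (frame S_0 does not occur; quantifying over it is harmless)
Conclusion : ∀ {m} (n : ℕ) → (State m → Bool) → (State m → State m → Bool)
             → (State m → Bool) → Set
Conclusion {m} n I T H =
  ∀ (σ : Frames m n) →
    I (σ (suc zero)) ≡ true →
    (∀ (j : Fin n) → T (σ (suc (inject₁ j))) (σ (suc (suc j))) ≡ true) →
    H (σ (fromℕ (suc n))) ≡ true

module Submission where

open import Defs
open import Data.Bool using (Bool; true)
open import Data.Nat using (ℕ)
open import Data.Fin using (Fin; zero; suc; inject₁; fromℕ)
open import Relation.Binary.PropositionalEquality using (_≡_)

-- Proof idea: given a trace satisfying the conclusion's hypotheses, overwrite frame 0
-- by frame 1.  Then I_0 holds because I_1 does, and T_{0,1} holds by stuttering, so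
-- the premise applies; frame n+1 is untouched, hence H holds there.

repeatFirstFrame : ∀ {m n} → Frames m n → Frames m n
repeatFirstFrame σ zero    = σ (suc zero)
repeatFirstFrame σ (suc j) = σ (suc j)

repeatFirstFrame-steps : ∀ {m n} (T : State m → State m → Bool) → Stuttering T →
  (σ : Frames m n) →
  (∀ (j : Fin n) → T (σ (suc (inject₁ j))) (σ (suc (suc j))) ≡ true) →
  ∀ (j : Fin (ℕ.suc n)) →
    T (repeatFirstFrame σ (inject₁ j)) (repeatFirstFrame σ (suc j)) ≡ true
repeatFirstFrame-steps T stutter σ steps zero    = stutter (σ (suc zero))
repeatFirstFrame-steps T stutter σ steps (suc j) = steps j

proposition3 : (m : ℕ) (I : State m → Bool) (T : State m → State m → Bool)
               → Stuttering T → (n : ℕ) (H : State m → Bool)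
               → Premise n I T H → Conclusion n I T H
proposition3 m I T stutter n H premise σ I₁ steps =
  premise (repeatFirstFrame σ) I₁ I₁ (repeatFirstFrame-steps T stutter σ steps)
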